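{- Let $\mathcal A\in\mathsf{Struc}_{c_1,c_2}$ be such that ${\rm id}_{U_{\mathcal A}}\in{\rm SDEC}_{\mathcal A}$, and let $P\subseteq U_{\mathcal A}^\infty$. If the characteristic function $\chi_P$ is computable by a BSS RAM in $\mathsf M_{\mathcal A}$, then $P\in{\rm DEC}_{\mathcal A}$.
   Context: A first-order structure $\mathcal A=(U_{\mathcal A};(c_i)_{i\in N_1};(f_i)_{i\in N_2};(r_i)_{i\in N_3})$ of finite signature consists of a universe, constants, operations and relations. ${\rm id}_{U_{\mathcal A}}=\{(x,x)\mid x\in U_{\mathcal A}\}\subseteq U_{\mathcal A}^2$. $U_{\mathcal A}^\infty=\bigcup_{n\ge 1}U_{\mathcal A}^n$. $\mathsf{Struc}_{c_1,c_2}$ is the class of structures having two distinct elements $c_1\neq c_2$ among their constants. A (deterministic) BSS RAM over $\mathcal A$ (class $\mathsf M_{\mathcal A}$) has registers $Z_1,Z_2,\dots$ for elements of $U_{\mathcal A}$, finitely many index registers $I_1,\dots,I_k$ for positive integers, and a finite program of labeled instructions ending with stop; instructions: $Z_j:=f_i(Z_{j_1},\dots,Z_{j_m})$, $Z_j:=c_i$, $Z_j:=Z_k$, $Z_{I_j}:=Z_{I_k}$, $I_j:=1$, $I_j:=I_j+1$, "if $r_i(Z_{j_1},\dots,Z_{j_k})$ then goto $\ell_1$ else goto $\ell_2$", "if $I_j=I_k$ then goto $\ell_1$ else goto $\ell_2$", stop, using only the constants, operations and relations of $\mathcal A$ (equality of elements of $U_{\mathcal A}$ can be tested directly only if the identity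 is a relation of $\mathcal A$). On input $(x_1,\dots,x_n)$: start at label 1 with $Z_i=x_i$ ($i\le n$), $Z_i=x_n$ ($i>n$), $I_1=n$, other index registers $1$; output $(Z_1,\dots,Z_{I_1})$ at stop. $H_{\mathcal M}$ = set of inputs on which $\mathcal M$ halts; ${\rm SDEC}_{\mathcal A}=\{H_{\mathcal M}\mid\mathcal M\in\mathsf M_{\mathcal A}\}$; ${\rm DEC}_{\mathcal A}$ = sets $P$ with $P$ and $U_{\mathcal A}^\infty\setminus P$ in ${\rm SDEC}_{\mathcal A}$. $\chi_P:U_{\mathcal A}^\infty\to\{c_1,c_2\}$ is $c_1$ on $P$ and $c_2$ elsewhere; it is computable by $\mathcal M$ if $\mathcal M$ halts on each input $\vec x$ with output the 1-tuple $\chi_P(\vec x)$. -}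

module Defs where

open import Data.Nat using (ℕ; zero; suc; _≡ᵇ_)
import Data.Fin as Fin
open import Data.Fin using (Fin; toℕ) renaming (_≟_ to _≟F_)
open import Data.Vec using (Vec; lookup; tabulate; last; map)
open import Data.List using (List)
import Data.Vec as V
open import Data.Bool using (if_then_else_)
open import Data.Maybe using (Maybe; just; nothing)
import Data.Sum
open import Data.Product using (Σ; _×_; _,_)
open import Relation.Nullary using (¬_; yes; no)
open import Relation.Binary.PropositionalEquality using (_≡_)
open import Relation.Binary.Construct.Closure.ReflexiveTransitive using (Star)

record Structure : Set₁ where
  field
    U      : Set
    n₁     : ℕ
    const  : Fin n₁ → U
    n₂     : ℕ
    opAr   : Fin n₂ → ℕ
    op     : (i : Fin n₂) → Vec U (opAr i) → U
    n₃     : ℕ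
    relAr  : Fin n₃ → ℕ
    rel    : (i : Fin n₃) → Vec U (relAr i) → Set

U∞ : Set → Set
U∞ U = Σ ℕ (λ n → Vec U (suc n))

-- Convention: register Z_{j+1} is named by j : ℕ; an index register
-- holding the positive integer v stores v - 1 : ℕ (so I := 1 stores 0,
-- and Z_{I_j} is the Z-register named by the stored value).
-- There are (suc k) index registers I_1 = zero, …, I_{k+1}.
-- Labels 1 … L+1 are represented by 0 … L (Fin (suc L) in jumps, ℕ in
-- configurations).

module _ (A : Structure) where
  open Structure A

  data Instr (k L : ℕ) : Set where
    opI    : (i : Fin n₂) (dst : ℕ) (args : Vec ℕ (opAr i)) → Instr k L
    constI : (i : Fin n₁) (dst : ℕ) → Instr k L
    copyI  : (dst src : ℕ) → Instr k L
    icopyI : (j j' : Fin (suc k)) → Instr k L          -- Z_{I_j} := Z_{I_j'}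
    isetI  : (j : Fin (suc k)) → Instr k L             -- I_j := 1
    iincI  : (j : Fin (suc k)) → Instr k L             -- I_j := I_j + 1
    relI   : (i : Fin n₃) (args : Vec ℕ (relAr i)) (ℓ₁ ℓ₂ : Fin (suc L)) → Instr k L
    ieqI   : (j j' : Fin (suc k)) (ℓ₁ ℓ₂ : Fin (suc L)) → Instr k L
    stopI  : Instr k L

  record Machine : Set where
    field
      k    : ℕ
      L    : ℕ
      prog : Vec (Instr k L) (suc L)
      ends : last prog ≡ stopI

  record Config (k : ℕ) : Set where
    constructor cfg
    field
      lbl : ℕ
      Z   : ℕ → U
      I   : Fin (suc k) → ℕ

  updZ : (ℕ → U) → ℕ → U → (ℕ → U)
  updZ f j u i = if i ≡ᵇ j then u else f i

  updI : ∀ {k} → (Fin (suc k) → ℕ) → Fin (suc k) → ℕ → (Fin (suc k) → ℕ)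
  updI f j v i with i ≟F j
  ... | yes _ = v
  ... | no  _ = f i

  module _ (M : Machine) where
    open Machine M

    fetch : ℕ → Maybe (Instr k L)
    fetch = go prog
      where
      go : ∀ {m} → Vec (Instr k L) m → ℕ → Maybe (Instr k L)
      go V.[] _ = nothing
      go (x V.∷ xs) zero = just x
      go (x V.∷ xs) (suc n) = go xs n

    data Step : Config k → Config k → Set where
      s-op : ∀ {ℓ Z I i dst args} → fetch ℓ ≡ just (opI i dst args) →
        Step (cfg ℓ Z I) (cfg (suc ℓ) (updZ Z dst (op i (map Z args))) I)
      s-const : ∀ {ℓ Z I i dst} → fetch ℓ ≡ just (constI i dst) →
        Step (cfg ℓ Z I) (cfg (suc ℓ) (updZ Z dst (const i)) I)
      s-copy : ∀ {ℓ Z I dst src} → fetch ℓ ≡ just (copyI dst src) →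
        Step (cfg ℓ Z I) (cfg (suc ℓ) (updZ Z dst (Z src)) I)
      s-icopy : ∀ {ℓ Z I j j'} → fetch ℓ ≡ just (icopyI j j') →
        Step (cfg ℓ Z I) (cfg (suc ℓ) (updZ Z (I j) (Z (I j'))) I)
      s-iset : ∀ {ℓ Z I j} → fetch ℓ ≡ just (isetI j) →
        Step (cfg ℓ Z I) (cfg (suc ℓ) Z (updI I j 0))
      s-iinc : ∀ {ℓ Z I j} → fetch ℓ ≡ just (iincI j) →
        Step (cfg ℓ Z I) (cfg (suc ℓ) Z (updI I j (suc (I j))))
      s-rel-yes : ∀ {ℓ Z I i args ℓ₁ ℓ₂} → fetch ℓ ≡ just (relI i args ℓ₁ ℓ₂) →
        rel i (map Z args) →
        Step (cfg ℓ Z I) (cfg (toℕ ℓ₁) Z I)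
      s-rel-no : ∀ {ℓ Z I i args ℓ₁ ℓ₂} → fetch ℓ ≡ just (relI i args ℓ₁ ℓ₂) →
        ¬ rel i (map Z args) →
        Step (cfg ℓ Z I) (cfg (toℕ ℓ₂) Z I)
      s-ieq-yes : ∀ {ℓ Z I j j' ℓ₁ ℓ₂} → fetch ℓ ≡ just (ieqI j j' ℓ₁ ℓ₂) →
        I j ≡ I j' →
        Step (cfg ℓ Z I) (cfg (toℕ ℓ₁) Z I)
      s-ieq-no : ∀ {ℓ Z I j j' ℓ₁ ℓ₂} → fetch ℓ ≡ just (ieqI j j' ℓ₁ ℓ₂) →
        ¬ (I j ≡ I j') →
        Step (cfg ℓ Z I) (cfg (toℕ ℓ₂) Z I)

    -- Initial configuration on input (x_1,…,x_{n+1}):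
    -- Z_i = x_i (i ≤ n+1), Z_i = x_{n+1} (i > n+1), I_1 = n+1 (stored n),
    -- the other index registers 1 (stored 0).
    initZ : ∀ {n} → Vec U (suc n) → ℕ → U
    initZ {n} xs i = go xs i
      where
      go : ∀ {m} → Vec U (suc m) → ℕ → U
      go (x V.∷ V.[]) _ = x
      go (x V.∷ (y V.∷ ys)) zero = x
      go (x V.∷ (y V.∷ ys)) (suc i) = go (y V.∷ ys) i

    initI : ℕ → Fin (suc k) → ℕ
    initI n Fin.zero = n
    initI n (Fin.suc _) = 0

    init : U∞ U → Config k
    init (n , xs) = cfg 0 (initZ xs) (initI n)

    Halted : Config k → Set
    Halted c = fetch (Config.lbl c) ≡ just stopI

    output : Config k → U∞ U
    output (cfg _ Z I) = I Fin.zero , tabulate (λ i → Z (toℕ i))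

    Halts : U∞ U → Set
    Halts x = Σ (Config k) λ c → Star Step (init x) c × Halted c

    Computes : U∞ U → U∞ U → Set
    Computes x y = Σ (Config k) λ c → Star Step (init x) c × Halted c × output c ≡ y

  SDEC : (U∞ U → Set) → Set
  SDEC P = Σ Machine λ M → ∀ x → (Halts M x → P x) × (P x → Halts M x)

  DEC : (U∞ U → Set) → Set
  DEC P = SDEC P × SDEC (λ x → ¬ P x)

  IdSet : U∞ U → Set
  IdSet (n , xs) = Σ U λ u → _≡_ {A = U∞ U} (n , xs) (1 , u V.∷ u V.∷ V.[])

  one : U → U∞ U
  one u = 0 , u V.∷ V.[]

  ComputesChar : U → U → (U∞ U → Set) → Machine → Set
  ComputesChar c₁ c₂ P M =
    ∀ x → Σ (U∞ U) λ y → Computes M x y ×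
      Data.Sum._⊎_ (P x × y ≡ one c₁) (¬ P x × y ≡ one c₂)

{-# OPTIONS --safe #-}
-- Let M compute χ_P and let E halt exactly on the pairs (u , u). For a constant c, a machine N runs M
-- and then E on (u , c), u being M's output; N halts on x iff χ_P(x) = c, so c = c₁ and c = c₂ give
-- semi-deciders of P and of its complement.
-- E has to be started on a fresh register file, but M may have written to unboundedly many registers
-- through its index registers. N therefore runs E with its registers shifted up by one, keeping c in
-- register 0, and maintains a watermark index register: E's registers at or above the watermark are
-- untouched padding (equal to c), and raising the watermark first copies c into the newly exposed
-- register. Since machines are deterministic and N spends at least one step per step of E, N halts
-- after the glue only if E halts on (u , c).
module Submission where

open import Defs
open import Data.Bool using (true; false)
open import Data.Empty using (⊥; ⊥-elim)
open import Data.Fin using (Fin; toℕ; combine; _↑ˡ_; _↑ʳ_) renaming (zero to fzero; suc to fsuc; _≟_ to _≟ᶠ_)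
open import Data.Fin.Properties using (toℕ-↑ˡ; toℕ-↑ʳ; toℕ-combine; ↑ˡ-injective; ↑ʳ-injective)
  renaming (suc-injective to fsuc-injective)
open import Data.List using (List; []; _∷_; length)
import Data.List as List
open import Data.Maybe using (Maybe; just; nothing)
open import Data.Maybe.Properties using (just-injective)
import Data.Maybe as Maybe
open import Data.Nat
open import Data.Nat.Properties
open import Data.Nat.Tactic.RingSolver using (solve-∀)
open import Function.Bundles using (_⇔_; mk⇔; Equivalence)
import Function.Properties.Equivalence as ⇔
open import Data.Product using (Σ; ∃; _×_; _,_; proj₁; proj₂)
import Data.Product as Product
open import Data.Sum using (_⊎_; inj₁; inj₂)
import Data.Sum as Sum
open import Data.Unit using (⊤; tt)
open import Data.Vec using (Vec; []; _∷_; _++_; map; lookup; concat; last)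
import Data.Vec as Vec
import Data.Vec.Properties as Vec
open import Relation.Binary.Construct.Closure.ReflexiveTransitive using (Star; ε; _◅_; _◅◅_)
open import Relation.Binary.PropositionalEquality
open import Relation.Binary.Rewriting using (Deterministic)
open import Relation.Nullary using (¬_; yes; no)

-- Deterministic transition systems and simulations

Terminates : {S : Set} → (S → S → Set) → (S → Set) → S → Set
Terminates _⟶_ Final s = Σ _ λ s' → Star _⟶_ s s' × Final s'

module DeterministicSystem {S : Set} {_⟶_ : S → S → Set} {Final : S → Set}
  (deterministic : Deterministic _≡_ _⟶_) (final-stuck : ∀ {s s'} → Final s → ¬ s ⟶ s') where

  resume : ∀ {s t h} → Star _⟶_ s t → Star _⟶_ s h → Final h → Star _⟶_ t h
  resume ε r _ = r
  resume (st ◅ _) ε fh = ⊥-elim (final-stuck fh st)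
  resume (st ◅ p) (st' ◅ r) fh with deterministic st st'
  ... | refl = resume p r fh

module ForwardSimulation {S T : Set} {_⇒_ : S → S → Set} {_⟶_ : T → T → Set}
  (_≈_ : T → S → Set)
  (simulate-step : ∀ {t s s'} → t ≈ s → s ⇒ s' → Σ T λ t' → Star _⟶_ t t' × t' ≈ s') where

  simulate : ∀ {t s s'} → t ≈ s → Star _⇒_ s s' → Σ T λ t' → Star _⟶_ t t' × t' ≈ s'
  simulate t≈s ε = _ , ε , t≈s
  simulate t≈s (ss ◅ run) with simulate-step t≈s ss
  ... | t₁ , run₁ , t₁≈s₁ with simulate t₁≈s₁ run
  ... | t' , run' , t'≈s' = t' , run₁ ◅◅ run' , t'≈s'

-- At least one simulator step per simulated step: with determinism, this lets termination be
-- reflected by induction on the simulator's run.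
module BackwardSimulation {S T : Set} {_⇒_ : S → S → Set} {Halted : S → Set}
  {_⟶_ : T → T → Set} {Final : T → Set}
  (deterministic : Deterministic _≡_ _⟶_) (final-stuck : ∀ {t t'} → Final t → ¬ t ⟶ t')
  (_≈_ : T → S → Set)
  (simulate-step : ∀ {t s s'} → t ≈ s → s ⇒ s' →
    Σ T λ t₁ → Σ T λ t' → t ⟶ t₁ × Star _⟶_ t₁ t' × t' ≈ s')
  (progress : ∀ {t t' s} → t ≈ s → t ⟶ t' → Halted s ⊎ ∃ (s ⇒_))
  (final⇒halted : ∀ {t s} → t ≈ s → Final t → Halted s) where

  private
    reflect : ∀ {t h} → Star _⟶_ t h → Final h →
      ∀ {t₀ s} → Star _⟶_ t t₀ → t₀ ≈ s → Terminates _⇒_ Halted s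
    reflect ε fh ε t≈s = _ , ε , final⇒halted t≈s fh
    reflect ε fh (st ◅ _) _ = ⊥-elim (final-stuck fh st)
    reflect (st ◅ run) fh (st' ◅ ahead) t≈s with deterministic st st'
    ... | refl = reflect run fh ahead t≈s
    reflect (st ◅ run) fh ε t≈s with progress t≈s st
    ... | inj₁ hs = _ , ε , hs
    ... | inj₂ (s' , ss) with simulate-step t≈s ss
    ... | t₁ , t' , st₁ , ahead , t'≈s' with deterministic st st₁
    ... | refl with reflect run fh ahead t'≈s'
    ... | s'' , run' , hs = s'' , ss ◅ run' , hs

  reflect-termination : ∀ {t s} → t ≈ s → Terminates _⟶_ Final t → Terminates _⇒_ Halted s
  reflect-termination t≈s (_ , run , fh) = reflect run fh ε t≈s

module _ {X : Set} where

  lookup? : ∀ {n} → Vec X n → ℕ → Maybe X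
  lookup? [] _ = nothing
  lookup? (x ∷ xs) zero = just x
  lookup? (x ∷ xs) (suc i) = lookup? xs i

  lookup?-unique : (g : ∀ {n} → Vec X n → ℕ → Maybe X) →
    (∀ i → g [] i ≡ nothing) →
    (∀ {n} x (xs : Vec X n) → g (x ∷ xs) zero ≡ just x) →
    (∀ {n} x (xs : Vec X n) i → g (x ∷ xs) (suc i) ≡ g xs i) →
    ∀ {n} (xs : Vec X n) i → g xs i ≡ lookup? xs i
  lookup?-unique g g-[] g-zero g-suc [] i = g-[] i
  lookup?-unique g g-[] g-zero g-suc (x ∷ xs) zero = g-zero x xs
  lookup?-unique g g-[] g-zero g-suc (x ∷ xs) (suc i) =
    trans (g-suc x xs i) (lookup?-unique g g-[] g-zero g-suc xs i)

  lookup?-++ : ∀ {m n} (xs : Vec X m) (ys : Vec X n) i → lookup? (xs ++ ys) (m + i) ≡ lookup? ys i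
  lookup?-++ [] ys i = refl
  lookup?-++ (x ∷ xs) ys i = lookup?-++ xs ys i

  lookup?-lookup : ∀ {m n} (xs : Vec X m) (ys : Vec X n) (i : Fin m) →
    lookup? (xs ++ ys) (toℕ i) ≡ just (lookup xs i)
  lookup?-lookup (x ∷ xs) ys fzero = refl
  lookup?-lookup (x ∷ xs) ys (fsuc i) = lookup?-lookup xs ys i

  lookup?-last : ∀ {n} (xs : Vec X (suc n)) → lookup? xs n ≡ just (last xs)
  lookup?-last (x ∷ []) = refl
  lookup?-last (x ∷ y ∷ ys) = lookup?-last (y ∷ ys)

  lookupOrLast : ∀ {n} → Vec X (suc n) → ℕ → X
  lookupOrLast (x ∷ []) _ = x
  lookupOrLast (x ∷ y ∷ ys) zero = x
  lookupOrLast (x ∷ y ∷ ys) (suc i) = lookupOrLast (y ∷ ys) i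

  lookupOrLast-unique : (g : ∀ {n} → Vec X (suc n) → ℕ → ∀ {m} → Vec X (suc m) → ℕ → X) →
    (∀ {n} (xs₀ : Vec X (suc n)) i₀ x i → g xs₀ i₀ (x ∷ []) i ≡ x) →
    (∀ {n} (xs₀ : Vec X (suc n)) i₀ {m} x y (ys : Vec X m) → g xs₀ i₀ (x ∷ y ∷ ys) zero ≡ x) →
    (∀ {n} (xs₀ : Vec X (suc n)) i₀ {m} x y (ys : Vec X m) i →
      g xs₀ i₀ (x ∷ y ∷ ys) (suc i) ≡ g xs₀ i₀ (y ∷ ys) i) →
    ∀ {n} (xs₀ : Vec X (suc n)) i₀ {m} (xs : Vec X (suc m)) i → g xs₀ i₀ xs i ≡ lookupOrLast xs i
  lookupOrLast-unique g g-one g-zero g-suc xs₀ i₀ (x ∷ []) i = g-one xs₀ i₀ x i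
  lookupOrLast-unique g g-one g-zero g-suc xs₀ i₀ (x ∷ y ∷ ys) zero = g-zero xs₀ i₀ x y ys
  lookupOrLast-unique g g-one g-zero g-suc xs₀ i₀ (x ∷ y ∷ ys) (suc i) =
    trans (g-suc xs₀ i₀ x y ys i) (lookupOrLast-unique g g-one g-zero g-suc xs₀ i₀ (y ∷ ys) i)

module _ {X Y : Set} where

  lookup?-map-++ : ∀ {m n} (f : Y → X) (xs : Vec Y m) (ys : Vec X n) i {x} →
    lookup? xs i ≡ just x → lookup? (map f xs ++ ys) i ≡ just (f x)
  lookup?-map-++ f (x ∷ xs) ys zero refl = refl
  lookup?-map-++ f (x ∷ xs) ys (suc i) eq = lookup?-map-++ f xs ys i eq

  lookup?-concat : ∀ {b n} (block : Y → Vec X b) (xs : Vec Y n) i (j : Fin b) →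
    lookup? (concat (map block xs)) (b * i + toℕ j) ≡ Maybe.map (λ y → lookup (block y) j) (lookup? xs i)
  lookup?-concat block [] i j = refl
  lookup?-concat {b} block (x ∷ xs) zero j rewrite *-zeroʳ b = lookup?-lookup (block x) _ j
  lookup?-concat {b} {suc n} block (x ∷ xs) (suc i) j = begin
    lookup? (block x ++ rest) (b * suc i + toℕ j)  ≡⟨ cong (lookup? (block x ++ rest)) shift ⟩
    lookup? (block x ++ rest) (b + (b * i + toℕ j)) ≡⟨ lookup?-++ (block x) rest (b * i + toℕ j) ⟩
    lookup? rest (b * i + toℕ j)                     ≡⟨ lookup?-concat block xs i j ⟩
    Maybe.map (λ y → lookup (block y) j) (lookup? xs i) ∎
    where
    open ≡-Reasoning
    rest : Vec X (n * b)
    rest = concat (map block xs)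
    shift : b * suc i + toℕ j ≡ b + (b * i + toℕ j)
    shift = trans (cong (_+ toℕ j) (*-suc b i)) (+-assoc b (b * i) (toℕ j))

maxᵛ : ∀ {n} → Vec ℕ n → ℕ
maxᵛ = Vec.foldr′ _⊔_ 0

lookup?⇒≤maxᵛ : ∀ {n} (xs : Vec ℕ n) i {x} → lookup? xs i ≡ just x → x ≤ maxᵛ xs
lookup?⇒≤maxᵛ (x ∷ xs) zero refl = m≤m⊔n x (maxᵛ xs)
lookup?⇒≤maxᵛ (x ∷ xs) (suc i) eq = ≤-trans (lookup?⇒≤maxᵛ xs i eq) (m≤n⊔m x (maxᵛ xs))

lookup?-map : ∀ {X Y : Set} {n} (f : Y → X) (xs : Vec Y n) i → lookup? (map f xs) i ≡ Maybe.map f (lookup? xs i)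
lookup?-map f [] i = refl
lookup?-map f (x ∷ xs) zero = refl
lookup?-map f (x ∷ xs) (suc i) = lookup?-map f xs i

module MachineFacts (A : Structure) where
  open Structure A

  updZ-same : ∀ (Z : ℕ → U) d v → updZ A Z d v d ≡ v
  updZ-same Z d v with d ≡ᵇ d | ≡⇒≡ᵇ d d refl
  ... | true | _ = refl

  updZ-other : ∀ (Z : ℕ → U) d v r → ¬ r ≡ d → updZ A Z d v r ≡ Z r
  updZ-other Z d v r r≢d with r ≡ᵇ d | ≡ᵇ⇒≡ r d
  ... | true | r≡d = ⊥-elim (r≢d (r≡d tt))
  ... | false | _ = refl

  updZ-cong : ∀ {Z Z' : ℕ → U} {v v'} d → (∀ r → Z r ≡ Z' r) → v ≡ v' →
    ∀ r → updZ A Z d v r ≡ updZ A Z' d v' r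
  updZ-cong d Z≗Z' v≡v' r with r ≡ᵇ d
  ... | true = v≡v'
  ... | false = Z≗Z' r

  updI-same : ∀ {k} (I : Fin (suc k) → ℕ) j v → updI A I j v j ≡ v
  updI-same I j v with j ≟ᶠ j
  ... | yes _ = refl
  ... | no j≢j = ⊥-elim (j≢j refl)

  updI-other : ∀ {k} (I : Fin (suc k) → ℕ) j v i → ¬ i ≡ j → updI A I j v i ≡ I i
  updI-other I j v i i≢j with i ≟ᶠ j
  ... | yes i≡j = ⊥-elim (i≢j i≡j)
  ... | no _ = refl

  updI-reindex : ∀ {k k'} (ι : Fin (suc k) → Fin (suc k')) → (∀ {x y} → ι x ≡ ι y → x ≡ y) →
    ∀ {I' : Fin (suc k') → ℕ} {I : Fin (suc k) → ℕ} {v' v} → (∀ x → I' (ι x) ≡ I x) → v' ≡ v →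
    ∀ j x → updI A I' (ι j) v' (ι x) ≡ updI A I j v x
  updI-reindex ι ι-injective {I'} I'∘ι≗I v'≡v j x with x ≟ᶠ j
  ... | yes refl = trans (updI-same I' (ι x) _) v'≡v
  ... | no x≢j = trans (updI-other I' (ι j) _ (ι x) (λ eq → x≢j (ι-injective eq))) (I'∘ι≗I x)

  module _ (M : Machine A) where
    open Machine M

    -- The local functions `go` of fetch and initZ cannot be named. They are identified with lookup? and
    -- lookupOrLast through their defining equations; `with` first makes them appear applied to fresh
    -- variables, so that unification finds the function argument of the uniqueness lemma. The `go` of
    -- initZ also receives the arguments of the outer call, hence the xs₀ i₀ of lookupOrLast-unique.
    fetch≡lookup? : ∀ ℓ → fetch A M ℓ ≡ lookup? prog ℓ
    fetch≡lookup? with lookup?-unique _ (λ _ → refl) (λ _ _ → refl) (λ _ _ _ → refl)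
    ... | unique with suc L | prog
    ... | _ | instrs = unique instrs

    initZ≡lookupOrLast : ∀ {n} (xs : Vec U (suc n)) i → initZ A M xs i ≡ lookupOrLast xs i
    initZ≡lookupOrLast
      with lookupOrLast-unique _ (λ _ _ _ _ → refl) (λ _ _ _ _ _ → refl) (λ _ _ _ _ _ _ → refl)
    ... | unique = by-cases
      where
      by-cases : ∀ {n} (xs : Vec U (suc n)) i → initZ A M xs i ≡ lookupOrLast xs i
      by-cases (x ∷ []) i = refl
      by-cases (x ∷ y ∷ ys) zero = refl
      by-cases {suc n} (x ∷ y ∷ ys) (suc i) with suc n | x Vec.∷ y Vec.∷ ys | suc i
      ... | _ | outer | i₀ with n | y Vec.∷ ys | i
      ... | _ | inner | j = unique outer i₀ inner j

    Effect : Config A k → Instr A k L → Config A k → Set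
    Effect (cfg ℓ Z I) (opI i dst args) c' = c' ≡ cfg (suc ℓ) (updZ A Z dst (op i (map Z args))) I
    Effect (cfg ℓ Z I) (constI i dst) c' = c' ≡ cfg (suc ℓ) (updZ A Z dst (const i)) I
    Effect (cfg ℓ Z I) (copyI dst src) c' = c' ≡ cfg (suc ℓ) (updZ A Z dst (Z src)) I
    Effect (cfg ℓ Z I) (icopyI j j') c' = c' ≡ cfg (suc ℓ) (updZ A Z (I j) (Z (I j'))) I
    Effect (cfg ℓ Z I) (isetI j) c' = c' ≡ cfg (suc ℓ) Z (updI A I j 0)
    Effect (cfg ℓ Z I) (iincI j) c' = c' ≡ cfg (suc ℓ) Z (updI A I j (suc (I j)))
    Effect (cfg ℓ Z I) (relI i args ℓ₁ ℓ₂) c' =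
      rel i (map Z args) × c' ≡ cfg (toℕ ℓ₁) Z I ⊎ ¬ rel i (map Z args) × c' ≡ cfg (toℕ ℓ₂) Z I
    Effect (cfg ℓ Z I) (ieqI j j' ℓ₁ ℓ₂) c' =
      I j ≡ I j' × c' ≡ cfg (toℕ ℓ₁) Z I ⊎ ¬ I j ≡ I j' × c' ≡ cfg (toℕ ℓ₂) Z I
    Effect c stopI c' = ⊥

    step-effect : ∀ {c c'} → Step A M c c' →
      Σ (Instr A k L) λ ins → fetch A M (Config.lbl c) ≡ just ins × Effect c ins c'
    step-effect (s-op eq) = _ , eq , refl
    step-effect (s-const eq) = _ , eq , refl
    step-effect (s-copy eq) = _ , eq , refl
    step-effect (s-icopy eq) = _ , eq , refl
    step-effect (s-iset eq) = _ , eq , refl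
    step-effect (s-iinc eq) = _ , eq , refl
    step-effect (s-rel-yes eq r) = _ , eq , inj₁ (r , refl)
    step-effect (s-rel-no eq ¬r) = _ , eq , inj₂ (¬r , refl)
    step-effect (s-ieq-yes eq e) = _ , eq , inj₁ (e , refl)
    step-effect (s-ieq-no eq ¬e) = _ , eq , inj₂ (¬e , refl)

    effect-functional : ∀ c ins {c₁ c₂} → Effect c ins c₁ → Effect c ins c₂ → c₁ ≡ c₂
    effect-functional (cfg _ _ _) (opI _ _ _) refl refl = refl
    effect-functional (cfg _ _ _) (constI _ _) refl refl = refl
    effect-functional (cfg _ _ _) (copyI _ _) refl refl = refl
    effect-functional (cfg _ _ _) (icopyI _ _) refl refl = refl
    effect-functional (cfg _ _ _) (isetI _) refl refl = refl
    effect-functional (cfg _ _ _) (iincI _) refl refl = refl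
    effect-functional (cfg _ _ _) (relI _ _ _ _) (inj₁ (_ , refl)) (inj₁ (_ , refl)) = refl
    effect-functional (cfg _ _ _) (relI _ _ _ _) (inj₁ (r , _)) (inj₂ (¬r , _)) = ⊥-elim (¬r r)
    effect-functional (cfg _ _ _) (relI _ _ _ _) (inj₂ (¬r , _)) (inj₁ (r , _)) = ⊥-elim (¬r r)
    effect-functional (cfg _ _ _) (relI _ _ _ _) (inj₂ (_ , refl)) (inj₂ (_ , refl)) = refl
    effect-functional (cfg _ _ _) (ieqI _ _ _ _) (inj₁ (_ , refl)) (inj₁ (_ , refl)) = refl
    effect-functional (cfg _ _ _) (ieqI _ _ _ _) (inj₁ (e , _)) (inj₂ (¬e , _)) = ⊥-elim (¬e e)
    effect-functional (cfg _ _ _) (ieqI _ _ _ _) (inj₂ (¬e , _)) (inj₁ (e , _)) = ⊥-elim (¬e e)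
    effect-functional (cfg _ _ _) (ieqI _ _ _ _) (inj₂ (_ , refl)) (inj₂ (_ , refl)) = refl

    step-deterministic : Deterministic _≡_ (Step A M)
    step-deterministic {c} s₁ s₂ with step-effect s₁ | step-effect s₂
    ... | ins , eq₁ , e₁ | _ , eq₂ , e₂ with trans (sym eq₁) eq₂
    ... | refl = effect-functional c ins e₁ e₂

    halted-stuck : ∀ {c c'} → Halted A M c → ¬ Step A M c c'
    halted-stuck halted s with step-effect s
    ... | _ , eq , e with trans (sym halted) eq
    ... | refl = e

module StraightLine (A : Structure) where
  open Structure A
  open MachineFacts A

  data Straight (k : ℕ) : Set where
    copy : (dst src : ℕ) → Straight k
    load : (i : Fin n₁) (dst : ℕ) → Straight k
    reset : (j : Fin (suc k)) → Straight k
    incr : (j : Fin (suc k)) → Straight k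

  module _ {k : ℕ} where

    Store : Set
    Store = (ℕ → U) × (Fin (suc k) → ℕ)

    at : ℕ → Store → Config A k
    at ℓ (Z , I) = cfg ℓ Z I

    instr : ∀ {L} → Straight k → Instr A k L
    instr (copy dst src) = copyI dst src
    instr (load i dst) = constI i dst
    instr (reset j) = isetI j
    instr (incr j) = iincI j

    exec₁ : Straight k → Store → Store
    exec₁ (copy dst src) (Z , I) = updZ A Z dst (Z src) , I
    exec₁ (load i dst) (Z , I) = updZ A Z dst (const i) , I
    exec₁ (reset j) (Z , I) = Z , updI A I j 0
    exec₁ (incr j) (Z , I) = Z , updI A I j (suc (I j))

    exec : List (Straight k) → Store → Store
    exec [] σ = σ
    exec (s ∷ ss) σ = exec ss (exec₁ s σ)

    exec-++ : ∀ ss ss' σ → exec (ss List.++ ss') σ ≡ exec ss' (exec ss σ)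
    exec-++ [] ss' σ = refl
    exec-++ (s ∷ ss) ss' σ = exec-++ ss ss' (exec₁ s σ)

    module _ {L : ℕ} where

      toVec : (ss : List (Straight k)) → Vec (Instr A k L) (length ss)
      toVec [] = []
      toVec (s ∷ ss) = instr s ∷ toVec ss

      Placed : ∀ {n} → Vec (Instr A k L) n → ℕ → List (Straight k) → Set
      Placed prog ℓ [] = ⊤
      Placed prog ℓ (s ∷ ss) = lookup? prog ℓ ≡ just (instr s) × Placed prog (suc ℓ) ss

      placed-∷ : ∀ {n} {prog : Vec (Instr A k L) n} {ℓ} x ss → Placed prog ℓ ss → Placed (x ∷ prog) (suc ℓ) ss
      placed-∷ x [] _ = tt
      placed-∷ x (s ∷ ss) (eq , placed) = eq , placed-∷ x ss placed

      placed-toVec : ∀ {n} ss (rest : Vec (Instr A k L) n) → Placed (toVec ss ++ rest) 0 ss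
      placed-toVec [] rest = tt
      placed-toVec (s ∷ ss) rest = refl , placed-∷ (instr s) ss (placed-toVec ss rest)

      placed-++ : ∀ {m n} (xs : Vec (Instr A k L) m) {ys : Vec (Instr A k L) n} {ℓ} ss →
        Placed ys ℓ ss → Placed (xs ++ ys) (m + ℓ) ss
      placed-++ {m} xs {ys} {ℓ} [] _ = tt
      placed-++ {m} xs {ys} {ℓ} (s ∷ ss) (eq , placed) =
        trans (lookup?-++ xs ys ℓ) eq , subst (λ ℓ' → Placed (xs ++ ys) ℓ' ss) (+-suc m ℓ) (placed-++ xs ss placed)

  run-straight : (M : Machine A) → let open Machine M in
    ∀ {ℓ} ss σ → Placed prog ℓ ss → Star (Step A M) (at ℓ σ) (at (ℓ + length ss) (exec ss σ))
  run-straight M {ℓ} [] σ _ = subst (λ ℓ' → Star (Step A M) (at ℓ σ) (at ℓ' σ)) (sym (+-identityʳ ℓ)) ε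
  run-straight M {ℓ} (s ∷ ss) σ (eq , placed) =
    step s σ (trans (fetch≡lookup? M ℓ) eq) ◅ subst Run (sym (+-suc ℓ (length ss))) (run-straight M ss (exec₁ s σ) placed)
    where
    open Machine M
    Run : ℕ → Set
    Run ℓ' = Star (Step A M) (at (suc ℓ) (exec₁ s σ)) (at ℓ' (exec ss (exec₁ s σ)))
    step : ∀ s σ → fetch A M ℓ ≡ just (instr s) → Step A M (at ℓ σ) (at (suc ℓ) (exec₁ s σ))
    step (copy dst src) (Z , I) eq = s-copy eq
    step (load i dst) (Z , I) eq = s-const eq
    step (reset j) (Z , I) eq = s-iset eq
    step (incr j) (Z , I) eq = s-iinc eq

module Composite (A : Structure) (M E : Machine A) (e : Fin (Structure.n₁ A)) where
  open Structure A
  open MachineFacts A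
  open StraightLine A
  open Machine M using () renaming (k to kM; L to LM; prog to progM)
  open Machine E using () renaming (k to kE; L to LE; prog to progE; ends to endsE)

  c : U
  c = const e

  kN : ℕ
  kN = kM + suc (suc (suc kE))

  ιM : Fin (suc kM) → Fin (suc kN)
  ιM j = j ↑ˡ (3 + kE)

  top base : Fin (suc kN)
  top = suc kM ↑ʳ fzero
  base = suc kM ↑ʳ fsuc fzero

  ιE : Fin (suc kE) → Fin (suc kN)
  ιE j = suc kM ↑ʳ fsuc (fsuc j)

  maxAddress : Instr A kE LE → ℕ
  maxAddress (opI _ dst args) = dst ⊔ maxᵛ args
  maxAddress (constI _ dst) = dst
  maxAddress (copyI dst src) = dst ⊔ src
  maxAddress (relI _ args _ _) = maxᵛ args
  maxAddress _ = 0

  addressBound : ℕ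
  addressBound = suc (maxᵛ (map maxAddress progE))

  fill : ℕ → List (Straight kN)
  fill zero = []
  fill (suc n) = load e (suc (suc n)) ∷ fill n

  incrs : ℕ → Fin (suc kN) → List (Straight kN)
  incrs zero j = []
  incrs (suc n) j = incr j ∷ incrs n j

  setToOne : ∀ n → (Fin n → Fin (suc kN)) → List (Straight kN)
  setToOne zero js = []
  setToOne (suc n) js = reset (js fzero) ∷ incr (js fzero) ∷ setToOne n (λ j → js (fsuc j))

  glueTail : List (Straight kN)
  glueTail = setToOne (suc kE) ιE List.++ (incr (ιE fzero) ∷ [])

  glueIndices : List (Straight kN)
  glueIndices = reset base ∷ reset top ∷ incrs (suc addressBound) top List.++ glueTail

  -- Turns the final registers of M, with its output u in register 0, into N's counterpart of E's initial
  -- configuration on (u , c) (see Glue.final-≈E).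
  glue : List (Straight kN)
  glue = copy 1 0 ∷ load e 0 ∷ fill addressBound List.++ glueIndices

  LN : ℕ
  LN = LM + (length glue + suc LE * 3)

  blockPosition : ℕ → ℕ → ℕ
  blockPosition ℓ i = suc LM + (length glue + (3 * ℓ + i))

  glueStart : Fin (suc LN)
  glueStart = suc LM ↑ʳ fzero

  blockLabel : Fin (suc LE) → Fin (suc LN)
  blockLabel l = suc LM ↑ʳ (length glue ↑ʳ combine l fzero)

  fromM : Instr A kM LM → Instr A kN LN
  fromM (opI i dst args) = opI i dst args
  fromM (constI i dst) = constI i dst
  fromM (copyI dst src) = copyI dst src
  fromM (icopyI j j') = icopyI (ιM j) (ιM j')
  fromM (isetI j) = isetI (ιM j)
  fromM (iincI j) = iincI (ιM j)
  fromM (relI i args ℓ₁ ℓ₂) = relI i args (ℓ₁ ↑ˡ _) (ℓ₂ ↑ˡ _)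
  fromM (ieqI j j' ℓ₁ ℓ₂) = ieqI (ιM j) (ιM j') (ℓ₁ ↑ˡ _) (ℓ₂ ↑ˡ _)
  fromM stopI = ieqI top top glueStart glueStart

  -- base always stores 0, the address of the padding value c, so resetting it changes nothing.
  nop : Instr A kN LN
  nop = isetI base

  block : Instr A kE LE → Vec (Instr A kN LN) 3
  block (opI i dst args) = opI i (suc dst) (map suc args) ∷ nop ∷ nop ∷ []
  block (constI i dst) = constI i (suc dst) ∷ nop ∷ nop ∷ []
  block (copyI dst src) = copyI (suc dst) (suc src) ∷ nop ∷ nop ∷ []
  block (icopyI j j') = icopyI (ιE j) (ιE j') ∷ nop ∷ nop ∷ []
  block (isetI j) = isetI (ιE j) ∷ iincI (ιE j) ∷ nop ∷ []
  block (iincI j) = iincI top ∷ icopyI top base ∷ iincI (ιE j) ∷ []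
  block (relI i args ℓ₁ ℓ₂) = relI i (map suc args) (blockLabel ℓ₁) (blockLabel ℓ₂) ∷ nop ∷ nop ∷ []
  block (ieqI j j' ℓ₁ ℓ₂) = ieqI (ιE j) (ιE j') (blockLabel ℓ₁) (blockLabel ℓ₂) ∷ nop ∷ nop ∷ []
  block stopI = stopI ∷ stopI ∷ stopI ∷ []

  -- M's code (its stop turned into a jump to the glue), the glue, and a block of three instructions for
  -- each instruction of E, so that E's label ℓ corresponds to N's label blockPosition ℓ 0.
  prog : Vec (Instr A kN LN) (suc LN)
  prog = map fromM progM ++ (toVec glue ++ concat (map block progE))

  lookup?-block : ∀ ℓ (i : Fin 3) →
    lookup? prog (blockPosition ℓ (toℕ i)) ≡ Maybe.map (λ ins → lookup (block ins) i) (lookup? progE ℓ)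
  lookup?-block ℓ i =
    trans (lookup?-++ (map fromM progM) _ _)
      (trans (lookup?-++ (toVec glue) _ _) (lookup?-concat block progE ℓ i))

  prog-ends : last prog ≡ stopI
  prog-ends = just-injective (begin
    just (last prog)                   ≡⟨ lookup?-last prog ⟨
    lookup? prog LN                    ≡⟨ cong (lookup? prog) (last-position LM (length glue) LE) ⟩
    lookup? prog (blockPosition LE 2)  ≡⟨ lookup?-block LE (fsuc (fsuc fzero)) ⟩
    Maybe.map (λ ins → lookup (block ins) (fsuc (fsuc fzero))) (lookup? progE LE)
                                       ≡⟨ cong (Maybe.map _) (trans (lookup?-last progE) (cong just endsE)) ⟩
    just stopI                         ∎)
    where
    open ≡-Reasoning
    last-position : ∀ a b x → a + (b + suc x * 3) ≡ suc a + (b + (3 * x + 2))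
    last-position = solve-∀

  N : Machine A
  N = record { k = kN ; L = LN ; prog = prog ; ends = prog-ends }

  fetch-fromM : ∀ {ℓ ins} → fetch A M ℓ ≡ just ins → fetch A N ℓ ≡ just (fromM ins)
  fetch-fromM {ℓ} eq =
    trans (fetch≡lookup? N ℓ) (lookup?-map-++ fromM progM _ ℓ (trans (sym (fetch≡lookup? M ℓ)) eq))

  ιM-injective : ∀ {x y} → ιM x ≡ ιM y → x ≡ y
  ιM-injective = ↑ˡ-injective (3 + kE) _ _

  record _≈M_ (n : Config A kN) (m : Config A kM) : Set where
    field
      same-label : Config.lbl n ≡ Config.lbl m
      same-registers : ∀ r → Config.Z n r ≡ Config.Z m r
      same-indices : ∀ j → Config.I n (ιM j) ≡ Config.I m j
  open _≈M_

  init-≈M : ∀ x → init A N x ≈M init A M x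
  init-≈M (n , xs) = record
    { same-label = refl
    ; same-registers = λ r → trans (initZ≡lookupOrLast N xs r) (sym (initZ≡lookupOrLast M xs r))
    ; same-indices = λ { fzero → refl ; (fsuc j) → refl } }

  simulate-M-step : ∀ {n m m'} → n ≈M m → Step A M m m' → Σ (Config A kN) λ n' → Step A N n n' × n' ≈M m'
  simulate-M-step {cfg ℓ Z I} {cfg ℓm Zm Im} n≈m = go
    where
    here : ∀ {ins} → fetch A M ℓm ≡ just ins → fetch A N ℓ ≡ just (fromM ins)
    here eq = trans (cong (fetch A N) (same-label n≈m)) (fetch-fromM eq)
    Z≗ : ∀ r → Z r ≡ Zm r
    Z≗ = same-registers n≈m
    I∘ιM≗ : ∀ j → I (ιM j) ≡ Im j
    I∘ιM≗ = same-indices n≈m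
    args≡ : ∀ {a} (args : Vec ℕ a) → map Z args ≡ map Zm args
    args≡ = Vec.map-cong Z≗
    next : ∀ {Z' Zm' I' Im'} → (∀ r → Z' r ≡ Zm' r) → (∀ j → I' (ιM j) ≡ Im' j) →
      cfg (suc ℓ) Z' I' ≈M cfg (suc ℓm) Zm' Im'
    next Z'≗ I'≗ = record { same-label = cong suc (same-label n≈m) ; same-registers = Z'≗ ; same-indices = I'≗ }
    jump : ∀ (l : Fin (suc LM)) → cfg (toℕ (l ↑ˡ (length glue + suc LE * 3))) Z I ≈M cfg (toℕ l) Zm Im
    jump l = record { same-label = toℕ-↑ˡ l _ ; same-registers = Z≗ ; same-indices = I∘ιM≗ }
    go : ∀ {m'} → Step A M (cfg ℓm Zm Im) m' → Σ (Config A kN) λ n' → Step A N (cfg ℓ Z I) n' × n' ≈M m'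
    go (s-op {i = i} {dst} {args} eq) =
      _ , s-op (here eq) , next (updZ-cong dst Z≗ (cong (op i) (args≡ args))) I∘ιM≗
    go (s-const {dst = dst} eq) = _ , s-const (here eq) , next (updZ-cong dst Z≗ refl) I∘ιM≗
    go (s-copy {dst = dst} {src} eq) = _ , s-copy (here eq) , next (updZ-cong dst Z≗ (Z≗ src)) I∘ιM≗
    go (s-icopy {j = j} {j'} eq) = _ , s-icopy (here eq) , next copied I∘ιM≗
      where
      copied : ∀ r → updZ A Z (I (ιM j)) (Z (I (ιM j'))) r ≡ updZ A Zm (Im j) (Zm (Im j')) r
      copied r = trans (cong (λ d → updZ A Z d (Z (I (ιM j'))) r) (I∘ιM≗ j))
        (updZ-cong (Im j) Z≗ (trans (cong Z (I∘ιM≗ j')) (Z≗ (Im j'))) r)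
    go (s-iset {j = j} eq) = _ , s-iset (here eq) , next Z≗ (updI-reindex ιM ιM-injective I∘ιM≗ refl j)
    go (s-iinc {j = j} eq) =
      _ , s-iinc (here eq) , next Z≗ (updI-reindex ιM ιM-injective I∘ιM≗ (cong suc (I∘ιM≗ j)) j)
    go (s-rel-yes {i = i} {args} {ℓ₁} eq r) =
      _ , s-rel-yes (here eq) (subst (rel i) (sym (args≡ args)) r) , jump ℓ₁
    go (s-rel-no {i = i} {args} {ℓ₂ = ℓ₂} eq ¬r) =
      _ , s-rel-no (here eq) (λ r → ¬r (subst (rel i) (args≡ args) r)) , jump ℓ₂
    go (s-ieq-yes {j = j} {j'} {ℓ₁} eq e) =
      _ , s-ieq-yes (here eq) (trans (I∘ιM≗ j) (trans e (sym (I∘ιM≗ j')))) , jump ℓ₁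
    go (s-ieq-no {j = j} {j'} {ℓ₂ = ℓ₂} eq ¬e) =
      _ , s-ieq-no (here eq) (λ e → ¬e (trans (sym (I∘ιM≗ j)) (trans e (I∘ιM≗ j')))) , jump ℓ₂

  simulate-M : ∀ {n m m'} → n ≈M m → Star (Step A M) m m' →
    Σ (Config A kN) λ n' → Star (Step A N) n n' × n' ≈M m'
  simulate-M = ForwardSimulation.simulate _≈M_ λ n≈m mstep →
    let n' , nstep , n'≈m' = simulate-M-step n≈m mstep in n' , nstep ◅ ε , n'≈m'

  enter-glue : ∀ {n m} → n ≈M m → Halted A M m → Step A N n (cfg (toℕ glueStart) (Config.Z n) (Config.I n))
  enter-glue {cfg ℓ Z I} n≈m halted =
    s-ieq-yes (trans (cong (fetch A N) (same-label n≈m)) (fetch-fromM halted)) refl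

  fill-outside : ∀ n Z I r → r ≤ 1 ⊎ suc n < r → proj₁ (exec (fill n) (Z , I)) r ≡ Z r
  fill-outside zero Z I r _ = refl
  fill-outside (suc n) Z I r r∉ =
    trans (fill-outside n _ I r (weaken r∉)) (updZ-other Z _ c r (distinct r∉))
    where
    weaken : r ≤ 1 ⊎ suc (suc n) < r → r ≤ 1 ⊎ suc n < r
    weaken (inj₁ r≤1) = inj₁ r≤1
    weaken (inj₂ n+2<r) = inj₂ (<-trans (n<1+n (suc n)) n+2<r)
    distinct : r ≤ 1 ⊎ suc (suc n) < r → ¬ r ≡ suc (suc n)
    distinct (inj₁ (s≤s ())) refl
    distinct (inj₂ n+2<r) refl = <-irrefl refl n+2<r

  fill-inside : ∀ n Z I r → 2 ≤ r → r ≤ suc n → proj₁ (exec (fill n) (Z , I)) r ≡ c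
  fill-inside zero Z I r (s≤s (s≤s _)) (s≤s ())
  fill-inside (suc n) Z I r 2≤r r≤n+2 with m≤n⇒m<n∨m≡n r≤n+2
  ... | inj₁ (s≤s r≤n+1) = fill-inside n _ I r 2≤r r≤n+1
  ... | inj₂ refl = trans (fill-outside n _ I (suc (suc n)) (inj₂ ≤-refl)) (updZ-same Z _ c)

  incrs-registers : ∀ n j Z I → proj₁ (exec (incrs n j) (Z , I)) ≡ Z
  incrs-registers zero j Z I = refl
  incrs-registers (suc n) j Z I = incrs-registers n j Z _

  incrs-same : ∀ n j Z I → proj₂ (exec (incrs n j) (Z , I)) j ≡ n + I j
  incrs-same zero j Z I = refl
  incrs-same (suc n) j Z I =
    trans (incrs-same n j Z _) (trans (cong (n +_) (updI-same I j _)) (+-suc n (I j)))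

  incrs-other : ∀ n j Z I x → ¬ x ≡ j → proj₂ (exec (incrs n j) (Z , I)) x ≡ I x
  incrs-other zero j Z I x x≢j = refl
  incrs-other (suc n) j Z I x x≢j = trans (incrs-other n j Z _ x x≢j) (updI-other I j _ x x≢j)

  setToOne-registers : ∀ n js Z I → proj₁ (exec (setToOne n js) (Z , I)) ≡ Z
  setToOne-registers zero js Z I = refl
  setToOne-registers (suc n) js Z I = setToOne-registers n _ Z _

  setToOne-other : ∀ n js Z I x → (∀ j → ¬ x ≡ js j) → proj₂ (exec (setToOne n js) (Z , I)) x ≡ I x
  setToOne-other zero js Z I x x∉ = refl
  setToOne-other (suc n) js Z I x x∉ = trans (setToOne-other n _ Z _ x (λ j → x∉ (fsuc j)))
    (trans (updI-other _ (js fzero) _ x (x∉ fzero)) (updI-other I (js fzero) 0 x (x∉ fzero)))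

  setToOne-same : ∀ n js → (∀ {i j} → js i ≡ js j → i ≡ j) →
    ∀ Z I j → proj₂ (exec (setToOne n js) (Z , I)) (js j) ≡ 1
  setToOne-same (suc n) js js-injective Z I fzero =
    trans (setToOne-other n _ Z _ (js fzero) (λ j eq → 0≢suc (js-injective eq)))
      (trans (updI-same _ (js fzero) _) (cong suc (updI-same I (js fzero) 0)))
    where
    0≢suc : ∀ {j : Fin n} → ¬ fzero ≡ fsuc j
    0≢suc ()
  setToOne-same (suc n) js js-injective Z I (fsuc j) =
    setToOne-same n (λ j → js (fsuc j)) (λ eq → fsuc-injective (js-injective eq)) Z _ j

  top≢base : ¬ top ≡ base
  top≢base eq with ↑ʳ-injective (suc kM) fzero (fsuc fzero) eq
  ... | ()

  top≢ιE : ∀ j → ¬ top ≡ ιE j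
  top≢ιE j eq with ↑ʳ-injective (suc kM) fzero (fsuc (fsuc j)) eq
  ... | ()

  base≢ιE : ∀ j → ¬ base ≡ ιE j
  base≢ιE j eq with ↑ʳ-injective (suc kM) (fsuc fzero) (fsuc (fsuc j)) eq
  ... | ()

  ιE-injective : ∀ {i j} → ιE i ≡ ιE j → i ≡ j
  ιE-injective {i} {j} eq with ↑ʳ-injective (suc kM) (fsuc (fsuc i)) (fsuc (fsuc j)) eq
  ... | refl = refl

  blockPosition-+ : ∀ i ℓ → i + blockPosition ℓ 0 ≡ blockPosition ℓ i
  blockPosition-+ i ℓ = shift i (suc LM) (length glue) (3 * ℓ)
    where
    shift : ∀ i a b x → i + (a + (b + (x + 0))) ≡ a + (b + (x + i))
    shift = solve-∀

  blockPosition-next : ∀ ℓ → blockPosition ℓ 3 ≡ blockPosition (suc ℓ) 0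
  blockPosition-next ℓ = cong (λ x → suc LM + (length glue + x)) (next ℓ)
    where
    next : ∀ ℓ → 3 * ℓ + 3 ≡ 3 * suc ℓ + 0
    next = solve-∀

  toℕ-blockLabel : ∀ l → toℕ (blockLabel l) ≡ blockPosition (toℕ l) 0
  toℕ-blockLabel l = trans (toℕ-↑ʳ (suc LM) _) (cong (suc LM +_) (trans (toℕ-↑ʳ (length glue) _)
    (cong (length glue +_) (toℕ-combine l (fzero {2})))))

  -- E's register r is kept in N's register r + 1 while r is below the watermark I top; E's registers
  -- from the watermark on still hold the padding value c, which N keeps in register 0 (= Z (I base)).
  -- E's index value v is kept as v + 1, so that it addresses the shifted register.
  record _≈E_ (n : Config A kN) (m : Config A kE) : Set where
    field
      at-block : Config.lbl n ≡ blockPosition (Config.lbl m) 0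
      padding : Config.Z n 0 ≡ c
      below-top : ∀ r → r < Config.I n top → Config.Z n (suc r) ≡ Config.Z m r
      above-top : ∀ r → Config.I n top ≤ r → Config.Z m r ≡ c
      shifted-index : ∀ j → Config.I n (ιE j) ≡ suc (Config.I m j)
      index<top : ∀ j → Config.I m j < Config.I n top
      addressBound≤top : addressBound ≤ Config.I n top
      base-index : Config.I n base ≡ 0
  open _≈E_

  fetch-in-block : ∀ {n m} → n ≈E m → (i : Fin 3) →
    fetch A N (toℕ i + Config.lbl n) ≡ Maybe.map (λ ins → lookup (block ins) i) (fetch A E (Config.lbl m))
  fetch-in-block {n} {m} n≈m i = begin
    fetch A N (toℕ i + Config.lbl n)         ≡⟨ cong (λ ℓ → fetch A N (toℕ i + ℓ)) (at-block n≈m) ⟩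
    fetch A N (toℕ i + blockPosition ℓm 0)   ≡⟨ cong (fetch A N) (blockPosition-+ (toℕ i) ℓm) ⟩
    fetch A N (blockPosition ℓm (toℕ i))     ≡⟨ fetch≡lookup? N _ ⟩
    lookup? prog (blockPosition ℓm (toℕ i))  ≡⟨ lookup?-block ℓm i ⟩
    Maybe.map (λ ins → lookup (block ins) i) (lookup? progE ℓm)
                                             ≡⟨ cong (Maybe.map _) (fetch≡lookup? E ℓm) ⟨
    Maybe.map (λ ins → lookup (block ins) i) (fetch A E ℓm) ∎
    where
    open ≡-Reasoning
    ℓm : ℕ
    ℓm = Config.lbl m

  fetch-block : ∀ {n m ins} → n ≈E m → fetch A E (Config.lbl m) ≡ just ins → (i : Fin 3) →
    fetch A N (toℕ i + Config.lbl n) ≡ just (lookup (block ins) i)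
  fetch-block n≈m eq i = trans (fetch-in-block n≈m i) (cong (Maybe.map _) eq)

  next-block : ∀ {n m} → n ≈E m → 3 + Config.lbl n ≡ blockPosition (suc (Config.lbl m)) 0
  next-block {n} {m} n≈m = trans (cong (3 +_) (at-block n≈m))
    (trans (blockPosition-+ 3 (Config.lbl m)) (blockPosition-next (Config.lbl m)))

  address<top : ∀ {n m ins} → n ≈E m → fetch A E (Config.lbl m) ≡ just ins → maxAddress ins < Config.I n top
  address<top {m = m} {ins} n≈m eq = <-≤-trans (s≤s (lookup?⇒≤maxᵛ (map maxAddress progE) ℓm in-prog))
    (addressBound≤top n≈m)
    where
    ℓm : ℕ
    ℓm = Config.lbl m
    in-prog : lookup? (map maxAddress progE) ℓm ≡ just (maxAddress ins)
    in-prog = trans (lookup?-map maxAddress progE ℓm)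
      (cong (Maybe.map maxAddress) (trans (sym (fetch≡lookup? E ℓm)) eq))

  arguments-agree : ∀ {n m a} → n ≈E m → (args : Vec ℕ a) → maxᵛ args < Config.I n top →
    map (Config.Z n) (map suc args) ≡ map (Config.Z m) args
  arguments-agree n≈m [] _ = refl
  arguments-agree n≈m (r ∷ args) max<top = cong₂ _∷_
    (below-top n≈m r (≤-<-trans (m≤m⊔n r _) max<top))
    (arguments-agree n≈m args (≤-<-trans (m≤n⊔m r _) max<top))

  ≈E-resp : ∀ {ℓ Z I Z' I' m} → cfg ℓ Z I ≈E m → (∀ r → Z r ≡ Z' r) → (∀ x → I x ≡ I' x) → cfg ℓ Z' I' ≈E m
  ≈E-resp n≈m Z≗Z' I≗I' = record
    { at-block = at-block n≈m
    ; padding = trans (sym (Z≗Z' 0)) (padding n≈m)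
    ; below-top = λ r r<top → trans (sym (Z≗Z' (suc r))) (below-top n≈m r (subst (r <_) (sym (I≗I' top)) r<top))
    ; above-top = λ r top≤r → above-top n≈m r (subst (_≤ r) (sym (I≗I' top)) top≤r)
    ; shifted-index = λ j → trans (sym (I≗I' (ιE j))) (shifted-index n≈m j)
    ; index<top = λ j → subst (_ <_) (I≗I' top) (index<top n≈m j)
    ; addressBound≤top = subst (addressBound ≤_) (I≗I' top) (addressBound≤top n≈m)
    ; base-index = trans (sym (I≗I' base)) (base-index n≈m) }

  ≈E-jump : ∀ {ℓ Z I ℓm Zm Im ℓ' ℓm'} → cfg ℓ Z I ≈E cfg ℓm Zm Im → ℓ' ≡ blockPosition ℓm' 0 →
    cfg ℓ' Z I ≈E cfg ℓm' Zm Im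
  ≈E-jump n≈m ℓ'≡ = record
    { at-block = ℓ'≡ ; padding = padding n≈m ; below-top = below-top n≈m ; above-top = above-top n≈m
    ; shifted-index = shifted-index n≈m ; index<top = index<top n≈m ; addressBound≤top = addressBound≤top n≈m
    ; base-index = base-index n≈m }

  ≈E-write : ∀ {ℓ Z I ℓm Zm Im ℓ' ℓm' d v v'} → cfg ℓ Z I ≈E cfg ℓm Zm Im → d < I top → v ≡ v' →
    ℓ' ≡ blockPosition ℓm' 0 → cfg ℓ' (updZ A Z (suc d) v) I ≈E cfg ℓm' (updZ A Zm d v') Im
  ≈E-write {Z = Z} {I} {Zm = Zm} {d = d} {v} {v'} n≈m d<top v≡v' ℓ'≡ = record
    { at-block = ℓ'≡ ; padding = padding n≈m
    ; below-top = below
    ; above-top = λ r top≤r → trans (updZ-other Zm d v' r (λ { refl → <⇒≱ d<top top≤r })) (above-top n≈m r top≤r)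
    ; shifted-index = shifted-index n≈m ; index<top = index<top n≈m ; addressBound≤top = addressBound≤top n≈m
    ; base-index = base-index n≈m }
    where
    below : ∀ r → r < I top → updZ A Z (suc d) v (suc r) ≡ updZ A Zm d v' r
    below r r<top with r ≡ᵇ d
    ... | true = v≡v'
    ... | false = below-top n≈m r r<top

  reset-base-idle : ∀ (I : Fin (suc kN) → ℕ) → I base ≡ 0 → ∀ x → updI A I base 0 x ≡ I x
  reset-base-idle I I-base≡0 x with x ≟ᶠ base
  ... | yes refl = sym I-base≡0
  ... | no _ = refl

  reset-base-twice-idle : ∀ (I : Fin (suc kN) → ℕ) → I base ≡ 0 → ∀ x → updI A (updI A I base 0) base 0 x ≡ I x
  reset-base-twice-idle I I-base≡0 x =
    trans (reset-base-idle _ (trans (reset-base-idle I I-base≡0 base) I-base≡0) x) (reset-base-idle I I-base≡0 x)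

  ≈E-reset : ∀ {ℓ Z I ℓm Zm Im} j → cfg ℓ Z I ≈E cfg ℓm Zm Im →
    let I₁ = updI A I (ιE j) 0 in
    cfg (3 + ℓ) Z (updI A (updI A I₁ (ιE j) (suc (I₁ (ιE j)))) base 0) ≈E cfg (suc ℓm) Zm (updI A Im j 0)
  ≈E-reset {ℓ} {Z} {I} {ℓm} {Zm} {Im} j n≈m =
    ≈E-resp {I = I₂} related (λ _ → refl) (λ x → sym (reset-base-idle I₂ (base-index related) x))
    where
    I₁ I₂ : Fin (suc kN) → ℕ
    I₁ = updI A I (ιE j) 0
    I₂ = updI A I₁ (ιE j) (suc (I₁ (ιE j)))
    other : ∀ x → ¬ x ≡ ιE j → I₂ x ≡ I x
    other x x≢ = trans (updI-other I₁ (ιE j) _ x x≢) (updI-other I (ιE j) 0 x x≢)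
    top-kept : I₂ top ≡ I top
    top-kept = other top (top≢ιE j)
    shifted : ∀ x → I₂ (ιE x) ≡ suc (updI A Im j 0 x)
    shifted x with x ≟ᶠ j
    ... | yes refl = trans (updI-same I₁ (ιE x) _) (cong suc (updI-same I (ιE x) 0))
    ... | no x≢j = trans (other (ιE x) (λ eq → x≢j (ιE-injective eq))) (shifted-index n≈m x)
    below : ∀ x → updI A Im j 0 x < I₂ top
    below x with x ≟ᶠ j
    ... | yes refl = subst (0 <_) (sym top-kept) (≤-trans (s≤s z≤n) (addressBound≤top n≈m))
    ... | no _ = subst (Im x <_) (sym top-kept) (index<top n≈m x)
    related : cfg (3 + ℓ) Z I₂ ≈E cfg (suc ℓm) Zm (updI A Im j 0)
    related = record
      { at-block = next-block n≈m ; padding = padding n≈m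
      ; below-top = λ r r<top → below-top n≈m r (subst (r <_) top-kept r<top)
      ; above-top = λ r top≤r → above-top n≈m r (subst (_≤ r) top-kept top≤r)
      ; shifted-index = shifted ; index<top = below
      ; addressBound≤top = subst (addressBound ≤_) (sym top-kept) (addressBound≤top n≈m)
      ; base-index = trans (other base (base≢ιE j)) (base-index n≈m) }

  -- Raising the watermark from h to h + 1 exposes E's register h, which still holds c; N copies c into
  -- the corresponding register h + 1 before using it.
  ≈E-incr : ∀ {ℓ Z I ℓm Zm Im} j → cfg ℓ Z I ≈E cfg ℓm Zm Im →
    let I₁ = updI A I top (suc (I top)) in
    cfg (3 + ℓ) (updZ A Z (I₁ top) (Z (I₁ base))) (updI A I₁ (ιE j) (suc (I₁ (ιE j))))
      ≈E cfg (suc ℓm) Zm (updI A Im j (suc (Im j)))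
  ≈E-incr {ℓ} {Z} {I} {ℓm} {Zm} {Im} j n≈m = ≈E-resp related (λ r → sym (written r)) (λ _ → refl)
    where
    h : ℕ
    h = I top
    I₁ I₃ : Fin (suc kN) → ℕ
    I₁ = updI A I top (suc h)
    I₃ = updI A I₁ (ιE j) (suc (I₁ (ιE j)))
    Z₂ : ℕ → U
    Z₂ = updZ A Z (suc h) (Z 0)
    written : ∀ r → updZ A Z (I₁ top) (Z (I₁ base)) r ≡ Z₂ r
    written r = cong₂ (λ d v → updZ A Z d v r) (updI-same I top _)
      (cong Z (trans (updI-other I top _ base (λ eq → top≢base (sym eq))) (base-index n≈m)))
    I₁-ιE : ∀ x → I₁ (ιE x) ≡ I (ιE x)
    I₁-ιE x = updI-other I top _ (ιE x) (λ eq → top≢ιE x (sym eq))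
    I₃-top : I₃ top ≡ suc h
    I₃-top = trans (updI-other I₁ (ιE j) _ top (top≢ιE j)) (updI-same I top _)
    below : ∀ r → r < I₃ top → Z₂ (suc r) ≡ Zm r
    below r r<top with r ≟ h
    ... | yes refl = trans (updZ-same Z (suc r) _) (trans (padding n≈m) (sym (above-top n≈m r ≤-refl)))
    ... | no r≢h = trans (updZ-other Z (suc h) _ (suc r) (λ eq → r≢h (suc-injective eq)))
      (below-top n≈m r (≤∧≢⇒< (s≤s⁻¹ (subst (r <_) I₃-top r<top)) r≢h))
    shifted : ∀ x → I₃ (ιE x) ≡ suc (updI A Im j (suc (Im j)) x)
    shifted x with x ≟ᶠ j
    ... | yes refl = trans (updI-same I₁ (ιE x) _) (cong suc (trans (I₁-ιE x) (shifted-index n≈m x)))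
    ... | no x≢j = trans (updI-other I₁ (ιE j) _ (ιE x) (λ eq → x≢j (ιE-injective eq)))
      (trans (I₁-ιE x) (shifted-index n≈m x))
    indices : ∀ x → updI A Im j (suc (Im j)) x < I₃ top
    indices x with x ≟ᶠ j
    ... | yes refl = subst (suc (Im x) <_) (sym I₃-top) (s≤s (index<top n≈m x))
    ... | no _ = subst (Im x <_) (sym I₃-top) (m<n⇒m<1+n (index<top n≈m x))
    related : cfg (3 + ℓ) Z₂ I₃ ≈E cfg (suc ℓm) Zm (updI A Im j (suc (Im j)))
    related = record
      { at-block = next-block n≈m
      ; padding = trans (updZ-other Z (suc h) (Z 0) 0 (λ ())) (padding n≈m)
      ; below-top = below
      ; above-top = λ r top≤r → above-top n≈m r (≤-trans (n≤1+n h) (subst (_≤ r) I₃-top top≤r))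
      ; shifted-index = shifted
      ; index<top = indices
      ; addressBound≤top = subst (addressBound ≤_) (sym I₃-top) (m≤n⇒m≤1+n (addressBound≤top n≈m))
      ; base-index = trans (updI-other I₁ (ιE j) _ base (base≢ιE j))
          (trans (updI-other I top _ base (λ eq → top≢base (sym eq))) (base-index n≈m)) }

  simulate-E-step : ∀ {n m m'} → n ≈E m → Step A E m m' →
    Σ (Config A kN) λ n₁ → Σ (Config A kN) λ n' → Step A N n n₁ × Star (Step A N) n₁ n' × n' ≈E m'
  simulate-E-step {cfg ℓ Z I} {cfg ℓm Zm Im} n≈m = go
    where
    Simulated : Config A kE → Set
    Simulated m' =
      Σ (Config A kN) λ n₁ → Σ (Config A kN) λ n' → Step A N (cfg ℓ Z I) n₁ × Star (Step A N) n₁ n' × n' ≈E m'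
    at-offset : ∀ {ins} → fetch A E ℓm ≡ just ins → (i : Fin 3) →
      fetch A N (toℕ i + ℓ) ≡ just (lookup (block ins) i)
    at-offset = fetch-block n≈m
    below-top-if : ∀ {ins d} → fetch A E ℓm ≡ just ins → d ≤ maxAddress ins → d < I top
    below-top-if eq ≤max = ≤-<-trans ≤max (address<top n≈m eq)
    args≡ : ∀ {ins a} → fetch A E ℓm ≡ just ins → (args : Vec ℕ a) → maxᵛ args ≤ maxAddress ins →
      map Z (map suc args) ≡ map Zm args
    args≡ eq args ≤max = arguments-agree n≈m args (below-top-if eq ≤max)
    index≡ : ∀ j → I (ιE j) ≡ suc (Im j)
    index≡ = shifted-index n≈m
    written : ∀ {Z' d v v'} → fetch A N (suc ℓ) ≡ just nop → fetch A N (suc (suc ℓ)) ≡ just nop →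
      Step A N (cfg ℓ Z I) (cfg (suc ℓ) Z' I) → (∀ r → updZ A Z (suc d) v r ≡ Z' r) → d < I top → v ≡ v' →
      Simulated (cfg (suc ℓm) (updZ A Zm d v') Im)
    written nop₁ nop₂ first Z≗Z' d<top v≡v' = _ , _ , first , s-iset nop₁ ◅ s-iset nop₂ ◅ ε ,
      ≈E-resp (≈E-write n≈m d<top v≡v' (next-block n≈m)) Z≗Z'
        (λ x → sym (reset-base-twice-idle I (base-index n≈m) x))
    go : ∀ {m'} → Step A E (cfg ℓm Zm Im) m' → Simulated m'
    go (s-op {i = i} {dst} {args} eq) =
      written (at-offset eq (fsuc fzero)) (at-offset eq (fsuc (fsuc fzero))) (s-op (at-offset eq fzero)) (λ _ → refl)
        (below-top-if eq (m≤m⊔n dst _)) (cong (op i) (args≡ eq args (m≤n⊔m dst _)))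
    go (s-const eq) =
      written (at-offset eq (fsuc fzero)) (at-offset eq (fsuc (fsuc fzero))) (s-const (at-offset eq fzero)) (λ _ → refl)
        (below-top-if eq ≤-refl) refl
    go (s-copy {dst = dst} {src} eq) =
      written (at-offset eq (fsuc fzero)) (at-offset eq (fsuc (fsuc fzero))) (s-copy (at-offset eq fzero)) (λ _ → refl)
        (below-top-if eq (m≤m⊔n dst src)) (below-top n≈m src (below-top-if eq (m≤n⊔m dst src)))
    go (s-icopy {j = j} {j'} eq) =
      written (at-offset eq (fsuc fzero)) (at-offset eq (fsuc (fsuc fzero))) (s-icopy (at-offset eq fzero))
        (λ r → cong₂ (λ d v → updZ A Z d v r) (sym (index≡ j)) (cong Z (sym (index≡ j'))))
        (index<top n≈m j) (below-top n≈m (Im j') (index<top n≈m j'))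
    go (s-iset {j = j} eq) =
      _ , _ , s-iset (at-offset eq fzero) ,
      s-iinc (at-offset eq (fsuc fzero)) ◅ s-iset (at-offset eq (fsuc (fsuc fzero))) ◅ ε , ≈E-reset j n≈m
    go (s-iinc {j = j} eq) =
      _ , _ , s-iinc (at-offset eq fzero) ,
      s-icopy (at-offset eq (fsuc fzero)) ◅ s-iinc (at-offset eq (fsuc (fsuc fzero))) ◅ ε , ≈E-incr j n≈m
    go (s-rel-yes {i = i} {args} {ℓ₁} eq r) =
      _ , _ , s-rel-yes (at-offset eq fzero) (subst (rel i) (sym (args≡ eq args ≤-refl)) r) , ε ,
      ≈E-jump n≈m (toℕ-blockLabel ℓ₁)
    go (s-rel-no {i = i} {args} {ℓ₂ = ℓ₂} eq ¬r) =
      _ , _ , s-rel-no (at-offset eq fzero) (λ r → ¬r (subst (rel i) (args≡ eq args ≤-refl) r)) , ε ,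
      ≈E-jump n≈m (toℕ-blockLabel ℓ₂)
    go (s-ieq-yes {j = j} {j'} {ℓ₁} eq e) =
      _ , _ , s-ieq-yes (at-offset eq fzero) (trans (index≡ j) (trans (cong suc e) (sym (index≡ j')))) , ε ,
      ≈E-jump n≈m (toℕ-blockLabel ℓ₁)
    go (s-ieq-no {j = j} {j'} {ℓ₂ = ℓ₂} eq ¬e) =
      _ , _ , s-ieq-no (at-offset eq fzero) (λ e → ¬e (suc-injective (trans (sym (index≡ j)) (trans e (index≡ j'))))) ,
      ε ,
      ≈E-jump n≈m (toℕ-blockLabel ℓ₂)

  E-halted⇒N-halted : ∀ {n m} → n ≈E m → Halted A E m → Halted A N n
  E-halted⇒N-halted n≈m halted = fetch-block n≈m halted fzero

  block-head-stop : ∀ ins → lookup (block ins) fzero ≡ stopI → ins ≡ stopI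
  block-head-stop stopI _ = refl
  block-head-stop (opI _ _ _) ()
  block-head-stop (constI _ _) ()
  block-head-stop (copyI _ _) ()
  block-head-stop (icopyI _ _) ()
  block-head-stop (isetI _) ()
  block-head-stop (iincI _) ()
  block-head-stop (relI _ _ _ _) ()
  block-head-stop (ieqI _ _ _ _) ()

  N-halted⇒E-halted : ∀ {n m} → n ≈E m → Halted A N n → Halted A E m
  N-halted⇒E-halted {m = m} n≈m halted with fetch A E (Config.lbl m) | fetch-in-block n≈m fzero
  ... | nothing | fetchN with () ← trans (sym halted) fetchN
  ... | just ins | fetchN = cong just (block-head-stop ins (just-injective (trans (sym fetchN) halted)))

  progress : ∀ {n n' m} → n ≈E m → Step A N n n' → Halted A E m ⊎ ∃ (Step A E m)
  progress {cfg ℓ Z I} {m = cfg ℓm Zm Im} n≈m nstep with fetch A E ℓm in eq | step-effect N nstep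
  ... | nothing | _ , fetchN , _
    with () ← trans (sym fetchN) (trans (fetch-in-block n≈m fzero) (cong (Maybe.map _) eq))
  ... | just stopI | _ = inj₁ refl
  ... | just (opI _ _ _) | _ = inj₂ (_ , s-op eq)
  ... | just (constI _ _) | _ = inj₂ (_ , s-const eq)
  ... | just (copyI _ _) | _ = inj₂ (_ , s-copy eq)
  ... | just (icopyI _ _) | _ = inj₂ (_ , s-icopy eq)
  ... | just (isetI _) | _ = inj₂ (_ , s-iset eq)
  ... | just (iincI _) | _ = inj₂ (_ , s-iinc eq)
  ... | just (ieqI j j' _ _) | _ with Im j ≟ Im j'
  ...   | yes e = inj₂ (_ , s-ieq-yes eq e)
  ...   | no ¬e = inj₂ (_ , s-ieq-no eq ¬e)
  progress {cfg ℓ Z I} {m = cfg ℓm Zm Im} n≈m nstep | just (relI i args _ _) | _ , fetchN , effect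
    with just-injective (trans (sym fetchN) (fetch-block n≈m eq fzero))
  ... | refl with effect
  ...   | inj₁ (r , _) =
    inj₂ (_ , s-rel-yes eq (subst (rel i) (arguments-agree n≈m args (address<top n≈m eq)) r))
  ...   | inj₂ (¬r , _) =
    inj₂ (_ , s-rel-no eq (λ r → ¬r (subst (rel i) (sym (arguments-agree n≈m args (address<top n≈m eq))) r)))

  module Glue (Z₀ : ℕ → U) (I₀ : Fin (suc kN) → ℕ) where

    filled counted initialised final : Store
    filled = exec (fill addressBound) (updZ A (updZ A Z₀ 1 (Z₀ 0)) 0 c , I₀)
    counted = exec (incrs (suc addressBound) top) (proj₁ filled , reset-indices)
      where
      reset-indices : Fin (suc kN) → ℕ
      reset-indices = updI A (updI A (proj₂ filled) base 0) top 0
    initialised = exec (setToOne (suc kE) ιE) counted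
    final = exec₁ (incr (ιE fzero)) initialised

    glue-phases : exec glue (Z₀ , I₀) ≡ final
    glue-phases = trans (exec-++ (fill addressBound) glueIndices _)
      (trans (exec-++ (incrs (suc addressBound) top) glueTail _) (exec-++ (setToOne (suc kE) ιE) _ _))

    final-registers : proj₁ final ≡ proj₁ filled
    final-registers = trans (setToOne-registers (suc kE) ιE (proj₁ counted) (proj₂ counted))
      (incrs-registers (suc addressBound) top (proj₁ filled) _)

    final-other : ∀ x → (∀ j → ¬ x ≡ ιE j) → proj₂ final x ≡ proj₂ counted x
    final-other x x∉ = trans (updI-other (proj₂ initialised) (ιE fzero) _ x (x∉ fzero))
      (setToOne-other (suc kE) ιE (proj₁ counted) (proj₂ counted) x x∉)

    base≢top : ¬ base ≡ top
    base≢top eq = top≢base (sym eq)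

    final-top : proj₂ final top ≡ suc addressBound
    final-top = begin
      proj₂ final top                              ≡⟨ final-other top top≢ιE ⟩
      proj₂ counted top                            ≡⟨ incrs-same (suc addressBound) top (proj₁ filled) _ ⟩
      suc addressBound + updI A _ top 0 top        ≡⟨ cong (suc addressBound +_) (updI-same _ top 0) ⟩
      suc addressBound + 0                         ≡⟨ +-identityʳ (suc addressBound) ⟩
      suc addressBound                             ∎
      where open ≡-Reasoning

    final-base : proj₂ final base ≡ 0
    final-base = begin
      proj₂ final base                             ≡⟨ final-other base base≢ιE ⟩
      proj₂ counted base                           ≡⟨ incrs-other (suc addressBound) top _ _ base base≢top ⟩
      updI A (updI A (proj₂ filled) base 0) top 0 base ≡⟨ updI-other _ top 0 base base≢top ⟩
      updI A (proj₂ filled) base 0 base            ≡⟨ updI-same (proj₂ filled) base 0 ⟩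
      0                                            ∎
      where open ≡-Reasoning

    initialised-ιE : ∀ j → proj₂ initialised (ιE j) ≡ 1
    initialised-ιE = setToOne-same (suc kE) ιE ιE-injective (proj₁ counted) (proj₂ counted)

    final-ιE : ∀ j → proj₂ final (ιE j) ≡ suc (initI A E 1 j)
    final-ιE fzero = trans (updI-same (proj₂ initialised) (ιE fzero) _) (cong suc (initialised-ιE fzero))
    final-ιE (fsuc j) =
      trans (updI-other (proj₂ initialised) (ιE fzero) _ (ιE (fsuc j)) (λ eq → 0≢suc (ιE-injective (sym eq))))
        (initialised-ιE (fsuc j))
      where
      0≢suc : ¬ fzero ≡ fsuc j
      0≢suc ()

    final-≈E : at (blockPosition 0 0) final ≈E init A E (1 , Z₀ 0 ∷ c ∷ [])
    final-≈E = record
      { at-block = refl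
      ; padding = trans (cong (λ Z → Z 0) final-registers) (fill-outside addressBound _ I₀ 0 (inj₁ z≤n))
      ; below-top = below
      ; above-top = above
      ; shifted-index = final-ιE
      ; index<top = λ { fzero → subst (1 <_) (sym final-top) (s≤s (s≤s z≤n))
                      ; (fsuc j) → subst (0 <_) (sym final-top) (s≤s z≤n) }
      ; addressBound≤top = subst (addressBound ≤_) (sym final-top) (n≤1+n addressBound)
      ; base-index = final-base }
      where
      below : ∀ r → r < proj₂ final top → proj₁ final (suc r) ≡ initZ A E (Z₀ 0 ∷ c ∷ []) r
      below zero _ = trans (cong (λ Z → Z 1) final-registers) (fill-outside addressBound _ I₀ 1 (inj₁ ≤-refl))
      below (suc r) r<top = trans (cong (λ Z → Z (2 + r)) final-registers)
        (fill-inside addressBound _ I₀ (2 + r) (s≤s (s≤s z≤n)) (s≤s (s≤s⁻¹ (subst (suc r <_) final-top r<top))))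
      above : ∀ r → proj₂ final top ≤ r → initZ A E (Z₀ 0 ∷ c ∷ []) r ≡ c
      above zero top≤0 with () ← subst (_≤ 0) final-top top≤0
      above (suc r) _ = refl

  glue-placed : Placed prog (suc LM + 0) glue
  glue-placed = placed-++ (map fromM progM) glue (placed-toVec glue _)

  run-glue : ∀ Z₀ I₀ → Star (Step A N) (cfg (toℕ glueStart) Z₀ I₀) (at (blockPosition 0 0) (Glue.final Z₀ I₀))
  run-glue Z₀ I₀ = subst₂ (λ ℓ σ → Star (Step A N) (cfg ℓ Z₀ I₀) (at (blockPosition 0 0) σ))
    (sym (toℕ-↑ʳ (suc LM) fzero))
    (Glue.glue-phases Z₀ I₀)
    (subst (λ ℓ → Star (Step A N) (cfg (suc LM + 0) Z₀ I₀) (at ℓ (exec glue (Z₀ , I₀))))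
      (glue-end (suc LM) (length glue))
      (run-straight N glue (Z₀ , I₀) glue-placed))
    where
    glue-end : ∀ a b → a + 0 + b ≡ a + (b + (3 * 0 + 0))
    glue-end = solve-∀

  simulate-E : ∀ {n m m'} → n ≈E m → Star (Step A E) m m' →
    Σ (Config A kN) λ n' → Star (Step A N) n n' × n' ≈E m'
  simulate-E = ForwardSimulation.simulate _≈E_ λ n≈m estep →
    let _ , n' , nstep , nsteps , n'≈m' = simulate-E-step n≈m estep in n' , nstep ◅ nsteps , n'≈m'

  open BackwardSimulation (step-deterministic N) (halted-stuck N) _≈E_ simulate-E-step progress N-halted⇒E-halted
    using (reflect-termination)
  open DeterministicSystem {_⟶_ = Step A N} {Final = Halted A N} (step-deterministic N) (halted-stuck N) using (resume)

  module _ (x : U∞ U) {cM : Config A kM} (runM : Star (Step A M) (init A M x) cM) (haltedM : Halted A M cM) where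

    private
      lifted : Σ (Config A kN) λ nM → Star (Step A N) (init A N x) nM × nM ≈M cM
      lifted = simulate-M (init-≈M x) runM

      Z₀ : ℕ → U
      Z₀ = Config.Z (proj₁ lifted)

      glued : Config A kN
      glued = at (blockPosition 0 0) (Glue.final Z₀ (Config.I (proj₁ lifted)))

      run-to-glued : Star (Step A N) (init A N x) glued
      run-to-glued = proj₁ (proj₂ lifted) ◅◅ enter-glue (proj₂ (proj₂ lifted)) haltedM ◅ run-glue _ _

      glued-≈E : glued ≈E init A E (1 , Z₀ 0 ∷ c ∷ [])
      glued-≈E = Glue.final-≈E Z₀ (Config.I (proj₁ lifted))

      output≡ : Z₀ 0 ≡ Config.Z cM 0
      output≡ = same-registers (proj₂ (proj₂ lifted)) 0

      E-halts⇒N-halts : Halts A E (1 , Z₀ 0 ∷ c ∷ []) → Halts A N x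
      E-halts⇒N-halts (_ , runE , haltedE) =
        let n' , runN , n'≈m' = simulate-E glued-≈E runE in
        n' , run-to-glued ◅◅ runN , E-halted⇒N-halted n'≈m' haltedE

      N-halts⇒E-halts : Halts A N x → Halts A E (1 , Z₀ 0 ∷ c ∷ [])
      N-halts⇒E-halts (h , runN , haltedN) =
        reflect-termination glued-≈E (h , resume run-to-glued runN haltedN , haltedN)

    N-halts⇔E-halts : Halts A N x ⇔ Halts A E (1 , Config.Z cM 0 ∷ c ∷ [])
    N-halts⇔E-halts = mk⇔
      (λ h → subst (λ u → Halts A E (1 , u ∷ c ∷ [])) output≡ (N-halts⇒E-halts h))
      (λ h → E-halts⇒N-halts (subst (λ u → Halts A E (1 , u ∷ c ∷ [])) (sym output≡) h))

two-valued⇔ : ∀ {X Q : Set} {u c₁ c₂ : X} → ¬ c₁ ≡ c₂ → Q × u ≡ c₁ ⊎ ¬ Q × u ≡ c₂ →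
  (Q ⇔ u ≡ c₁) × ((¬ Q) ⇔ u ≡ c₂)
two-valued⇔ c₁≢c₂ (inj₁ (q , refl)) =
  mk⇔ (λ _ → refl) (λ _ → q) , mk⇔ (λ ¬q → ⊥-elim (¬q q)) (λ u≡c₂ → ⊥-elim (c₁≢c₂ u≡c₂))
two-valued⇔ c₁≢c₂ (inj₂ (¬q , refl)) =
  mk⇔ (λ q → ⊥-elim (¬q q)) (λ u≡c₁ → ⊥-elim (c₁≢c₂ (sym u≡c₁))) , mk⇔ (λ _ → refl) (λ _ → ¬q)

module _ (A : Structure) where
  open Structure A

  SemiDecides : Machine A → (U∞ U → Set) → Set
  SemiDecides E Q = ∀ x → (Halts A E x → Q x) × (Q x → Halts A E x)

  halts-pair⇔≡ : ∀ {E} → SemiDecides E (IdSet A) → ∀ u v → Halts A E (1 , u ∷ v ∷ []) ⇔ u ≡ v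
  halts-pair⇔≡ E-id u v = mk⇔
    (λ h → components≡ (proj₁ (E-id _) h))
    (λ { refl → proj₂ (E-id _) (u , refl) })
    where
    components≡ : IdSet A (1 , u ∷ v ∷ []) → u ≡ v
    components≡ (_ , refl) = refl

  output-head : ∀ (M : Machine A) cM {u} → output A M cM ≡ one A u → Config.Z cM 0 ≡ u
  output-head M (cfg _ _ _) eq = cong head eq
    where
    head : U∞ U → U
    head (_ , x ∷ _) = x

  record OutputTest (M : Machine A) (u : U) (Q : U∞ U → Set) (x : U∞ U) : Set where
    field
      final : Config A (Machine.k M)
      run : Star (Step A M) (init A M x) final
      halted : Halted A M final
      decides : Q x ⇔ Config.Z final 0 ≡ u

  χ-output-tests : ∀ {c₁ c₂ P M} → ¬ c₁ ≡ c₂ → ComputesChar A c₁ c₂ P M →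
    ∀ x → OutputTest M c₁ P x × OutputTest M c₂ (λ x → ¬ P x) x
  χ-output-tests {c₁} {c₂} {P} {M} c₁≢c₂ χ x with χ x
  ... | y , (cM , run , halted , output≡) , value =
    let P⇔ , ¬P⇔ = two-valued⇔ c₁≢c₂ (Sum.map (Product.map₂ read) (Product.map₂ read) value)
    in test P⇔ , test ¬P⇔
    where
    read : ∀ {u} → y ≡ one A u → Config.Z cM 0 ≡ u
    read y≡ = output-head M cM (trans output≡ y≡)
    test : ∀ {u Q} → Q x ⇔ Config.Z cM 0 ≡ u → OutputTest M u Q x
    test decides = record { final = cM ; run = run ; halted = halted ; decides = decides }

  SDEC-by-output-test : (M E : Machine A) → SemiDecides E (IdSet A) → (e : Fin n₁) → (Q : U∞ U → Set) →
    (∀ x → OutputTest M (const e) Q x) → SDEC A Q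
  SDEC-by-output-test M E E-id e Q test = Composite.N A M E e , λ x →
    let open OutputTest (test x)
        N⇔Q = ⇔.trans (Composite.N-halts⇔E-halts A M E e x run halted)
                (⇔.trans (halts-pair⇔≡ E-id _ _) (⇔.sym decides))
    in Equivalence.to N⇔Q , Equivalence.from N⇔Q

corollary6p5 : (A : Structure) (a b : Fin (Structure.n₁ A)) →
    ¬ (Structure.const A a ≡ Structure.const A b) →
    SDEC A (IdSet A) →
    (P : U∞ (Structure.U A) → Set) →
    (M : Machine A) → ComputesChar A (Structure.const A a) (Structure.const A b) P M →
    DEC A P
corollary6p5 A a b ca≢cb (E , E-id) P M χ =
  SDEC-by-output-test A M E E-id a P (λ x → proj₁ (tests x)) ,
  SDEC-by-output-test A M E E-id b (λ x → ¬ P x) (λ x → proj₂ (tests x))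
  where
  tests : ∀ x → OutputTest A M (Structure.const A a) P x × OutputTest A M (Structure.const A b) (λ x → ¬ P x) x
  tests = χ-output-tests A ca≢cb χ
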